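{- Let $f:\mathbb{N}\to\mathbb{C}$ be multiplicative and suppose $f(p^a)=0$ for all primes $p$ and all integers $a\ge 2$. Then for every $n\ge1$, $$f^{ -1\circ}(n)=(-1)^{\Omega(n)}\xi(n)\prod_p f(p)^{\nu_p(n)}=\lambda(n)\xi(n)\prod_p f(p)^{\nu_p(n)}$$ and $$f^{ -1*}(n)=(-1)^{\Omega(n)}\prod_p f(p)^{\nu_p(n)}=\lambda(n)\prod_p f(p)^{\nu_p(n)}.$$
   Context: A function $f:\mathbb{N}\to\mathbb{C}$ is multiplicative if $f(1)=1$ and $f(mn)=f(m)f(n)$ whenever $\gcd(m,n)=1$. For $n\in\mathbb{N}$ write $n=\prod_p p^{\nu_p(n)}$; $\Omega(n)=\sum_p\nu_p(n)$; $\lambda(n)=(-1)^{\Omega(n)}$ (Liouville function); $\xi(n)=\prod_p\nu_p(n)!$. The Dirichlet convolution is $(f*g)(n)=\sum_{d\mid n}f(d)g(n/d)$, the binomial convolution is $(f\circ g)(n)=\sum_{d\mid n}\left(\prod_p\binom{\nu_p(n)}{\nu_p(d)}\right)f(d)g(n/d)$, both with identity $\delta$ ($\delta(1)=1$, $\delta(n)=0$ for $n>1$); $f^{ -1\circ}$ and $f^{ -1*}$ denote the inverses of $f$ under $\circ$ and $*$ respectively. Convention $0^0=1$. -}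

module Defs where

open import Level using (Level)
open import Algebra.Bundles using (CommutativeRing)
open import Data.Nat.Base using (ℕ; zero; suc; _!; _≤_; _/_)
open import Data.Nat.Combinatorics using (_C_)
open import Data.Nat.Divisibility using (_∣_; _∣?_)
open import Data.Nat.Coprimality using (Coprime)
open import Data.Nat.Primality using (Prime; prime?)
open import Data.List.Base using (List; filter; upTo; map; foldr)
open import Data.Product using (_×_)
open import Relation.Nullary using (yes; no)

-- p-adic valuation ν_p(n) (fuel-based; fuel n suffices for p ≥ 2, n ≥ 1).
-- Only ever used for primes p.
νAux : ℕ → ℕ → ℕ → ℕ
νAux zero    p       n = 0
νAux (suc k) zero    n = 0
νAux (suc k) (suc q) n with suc q ∣? n
... | yes _ = suc (νAux k (suc q) (n / suc q))
... | no  _ = 0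

ν : ℕ → ℕ → ℕ
ν p n = νAux n p n

-- primes p ≤ n (for n ≥ 1 these are all primes with ν_p(n) possibly nonzero)
primesUpTo : ℕ → List ℕ
primesUpTo n = filter prime? (upTo (suc n))

sumℕ : List ℕ → ℕ
sumℕ = foldr Data.Nat.Base._+_ 0

prodℕ : List ℕ → ℕ
prodℕ = foldr Data.Nat.Base._*_ 1

Ω : ℕ → ℕ
Ω n = sumℕ (map (λ p → ν p n) (primesUpTo n))

ξ : ℕ → ℕ
ξ n = prodℕ (map (λ p → ν p n !) (primesUpTo n))

binomCoeff : ℕ → ℕ → ℕ
binomCoeff n d = prodℕ (map (λ p → ν p n C ν p d) (primesUpTo n))

module Arith {c ℓ : Level} (R : CommutativeRing c ℓ) where
  open CommutativeRing R

  pow : Carrier → ℕ → Carrier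
  pow x zero    = 1#
  pow x (suc k) = x * pow x k

  fromℕ : ℕ → Carrier
  fromℕ zero    = 0#
  fromℕ (suc k) = 1# + fromℕ k

  sumR : List Carrier → Carrier
  sumR = foldr _+_ 0#

  prodR : List Carrier → Carrier
  prodR = foldr _*_ 1#

  δ : ℕ → Carrier
  δ 1 = 1#
  δ _ = 0#

  dirichlet : (ℕ → Carrier) → (ℕ → Carrier) → ℕ → Carrier
  dirichlet f g n = sumR (map term (upTo n))
    where
    term : ℕ → Carrier
    term k with suc k ∣? n
    ... | yes _ = f (suc k) * g (n / suc k)
    ... | no  _ = 0#

  binomial : (ℕ → Carrier) → (ℕ → Carrier) → ℕ → Carrier
  binomial f g n = sumR (map term (upTo n))
    where
    term : ℕ → Carrier
    term k with suc k ∣? n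
    ... | yes _ = fromℕ (binomCoeff n (suc k)) * (f (suc k) * g (n / suc k))
    ... | no  _ = 0#

  Multiplicative : (ℕ → Carrier) → Set ℓ
  Multiplicative f = (f 1 ≈ 1#) ×
    (∀ m n → 1 ≤ m → 1 ≤ n → Coprime m n → f (m Data.Nat.Base.* n) ≈ f m * f n)

  IsBinomialInverse : (ℕ → Carrier) → (ℕ → Carrier) → Set ℓ
  IsBinomialInverse f g = ∀ n → 1 ≤ n → binomial f g n ≈ δ n

  IsDirichletInverse : (ℕ → Carrier) → (ℕ → Carrier) → Set ℓ
  IsDirichletInverse f g = ∀ n → 1 ≤ n → dirichlet f g n ≈ δ n

  primePowProd : (ℕ → Carrier) → ℕ → Carrier
  primePowProd f n = prodR (map (λ p → pow (f p) (ν p n)) (primesUpTo n))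

  liouville : ℕ → Carrier
  liouville n = pow (- 1#) (Ω n)

{-# OPTIONS --safe #-}
-- Both convolutions are weighted divisor sums Σ_{d ∣ n} W(n,d) f(d) g(n/d) with W(n,1) = 1, so,
-- as f(1) = 1, the equation (f ⋆ g)(n) = δ(n) determines g(n) from the values of g below n:
-- inverses are unique and it suffices to check the claimed formula G.  Write n = p^a m with p ∤ m.
-- The divisors of n are the p^i e with i ≤ a and e ∣ m, and W, f and G all split off their
-- p-parts (Ω, ξ, binomCoeff and Π_q f(q)^ν_q are products over primes), whence
--   (f ⋆ G)(p^a m) = (Σ_{i ≤ a} w(a,i) f(p^i) G_p(a − i)) · (f ⋆ G)(m),   w(a,i) = C(a,i) resp. 1.
-- Since f(p^i) = 0 for i ≥ 2, only i = 0 and i = 1 contribute; for the binomial convolution these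
-- are (−1)^a a! f(p)^a and a (−1)^(a−1) (a−1)! f(p)^a, which cancel (drop the factorials for the
-- Dirichlet one).  So (f ⋆ G)(n) = 0 for every n ≥ 2.

module Submission where

open import Defs
open import Level using (Level)
open import Algebra.Bundles using (CommutativeMonoid; CommutativeRing)
open import Data.Nat.Base using (ℕ; _≤_; _^_)
open import Data.Nat.Primality using (Prime)
open import Data.Product using (_×_; _,_)

module RangeFold {c ℓ : Level} (M : CommutativeMonoid c ℓ) where
  open import Data.Nat.Base using (zero; suc; _+_; _<_; z≤n; s≤s)
  open import Data.Nat.Properties using (suc-injective)
  open import Data.List.Base using ([]; _∷_; map; foldr; applyUpTo; upTo; filter)
  open import Relation.Binary.PropositionalEquality using (_≡_; _≢_; cong) renaming (refl to ≡-refl)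
  open import Relation.Nullary using (yes; no)
  open import Relation.Unary using (Pred; Decidable)
  open CommutativeMonoid M
  open import Relation.Binary.Reasoning.Setoid setoid
  open import Algebra.Properties.CommutativeSemigroup commutativeSemigroup using (interchange)

  Σ< : (ℕ → Carrier) → ℕ → Carrier
  Σ< t zero    = ε
  Σ< t (suc n) = t 0 ∙ Σ< (λ j → t (suc j)) n

  foldr-map-applyUpTo : ∀ (t : ℕ → Carrier) h n →
    foldr _∙_ ε (map t (applyUpTo h n)) ≡ Σ< (λ j → t (h j)) n
  foldr-map-applyUpTo t h zero    = ≡-refl
  foldr-map-applyUpTo t h (suc n) = cong (t (h 0) ∙_) (foldr-map-applyUpTo t (λ j → h (suc j)) n)

  foldr-map-upTo : ∀ (t : ℕ → Carrier) n → foldr _∙_ ε (map t (upTo n)) ≡ Σ< t n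
  foldr-map-upTo t = foldr-map-applyUpTo t (λ j → j)

  foldr-map-cong : ∀ {t u : ℕ → Carrier} → (∀ k → t k ≈ u k) → ∀ xs →
    foldr _∙_ ε (map t xs) ≈ foldr _∙_ ε (map u xs)
  foldr-map-cong t≈u []       = refl
  foldr-map-cong t≈u (x ∷ xs) = ∙-cong (t≈u x) (foldr-map-cong t≈u xs)

  Σ<-cong : ∀ {t u : ℕ → Carrier} n → (∀ j → j < n → t j ≈ u j) → Σ< t n ≈ Σ< u n
  Σ<-cong zero    t≈u = refl
  Σ<-cong (suc n) t≈u = ∙-cong (t≈u 0 (s≤s z≤n)) (Σ<-cong n (λ j j<n → t≈u (suc j) (s≤s j<n)))

  Σ<-∙ : ∀ (t u : ℕ → Carrier) n → Σ< (λ j → t j ∙ u j) n ≈ Σ< t n ∙ Σ< u n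
  Σ<-∙ t u zero    = sym (identityˡ ε)
  Σ<-∙ t u (suc n) = begin
    (t 0 ∙ u 0) ∙ Σ< (λ j → t (suc j) ∙ u (suc j)) n
      ≈⟨ ∙-congˡ (Σ<-∙ (λ j → t (suc j)) (λ j → u (suc j)) n) ⟩
    (t 0 ∙ u 0) ∙ (Σ< (λ j → t (suc j)) n ∙ Σ< (λ j → u (suc j)) n)
      ≈⟨ interchange (t 0) (u 0) _ _ ⟩
    (t 0 ∙ Σ< (λ j → t (suc j)) n) ∙ (u 0 ∙ Σ< (λ j → u (suc j)) n) ∎

  Σ<-ε : ∀ (t : ℕ → Carrier) n → (∀ j → j < n → t j ≈ ε) → Σ< t n ≈ ε
  Σ<-ε t zero    t≈ε = refl
  Σ<-ε t (suc n) t≈ε = trans (∙-cong (t≈ε 0 (s≤s z≤n)) (Σ<-ε _ n (λ j j<n → t≈ε (suc j) (s≤s j<n))))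
                             (identityˡ ε)

  Σ<-single : ∀ (t : ℕ → Carrier) n i → i < n → (∀ j → j < n → j ≢ i → t j ≈ ε) → Σ< t n ≈ t i
  Σ<-single t (suc n) zero    _         t≈ε =
    trans (∙-congˡ (Σ<-ε _ n (λ j j<n → t≈ε (suc j) (s≤s j<n) (λ ())))) (identityʳ (t 0))
  Σ<-single t (suc n) (suc i) (s≤s i<n) t≈ε =
    trans (∙-congʳ (t≈ε 0 (s≤s z≤n) (λ ())))
      (trans (identityˡ _)
        (Σ<-single _ n i i<n (λ j j<n j≢i → t≈ε (suc j) (s≤s j<n) (λ e → j≢i (suc-injective e)))))

  Σ<-extend : ∀ (t : ℕ → Carrier) n k → (∀ j → n ≤ j → j < n + k → t j ≈ ε) →
    Σ< t (n + k) ≈ Σ< t n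
  Σ<-extend t zero    k t≈ε = Σ<-ε t k (λ j j<k → t≈ε j z≤n j<k)
  Σ<-extend t (suc n) k t≈ε =
    ∙-congˡ (Σ<-extend _ n k (λ j n≤j j<n+k → t≈ε (suc j) (s≤s n≤j) (s≤s j<n+k)))

  Σ<-swap : ∀ (t : ℕ → ℕ → Carrier) m n →
    Σ< (λ i → Σ< (λ j → t i j) n) m ≈ Σ< (λ j → Σ< (λ i → t i j) m) n
  Σ<-swap t zero    n = sym (Σ<-ε _ n (λ _ _ → refl))
  Σ<-swap t (suc m) n = begin
    Σ< (t 0) n ∙ Σ< (λ i → Σ< (t (suc i)) n) m
      ≈⟨ ∙-congˡ (Σ<-swap (λ i → t (suc i)) m n) ⟩
    Σ< (t 0) n ∙ Σ< (λ j → Σ< (λ i → t (suc i) j) m) n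
      ≈⟨ sym (Σ<-∙ (t 0) (λ j → Σ< (λ i → t (suc i) j) m) n) ⟩
    Σ< (λ j → t 0 j ∙ Σ< (λ i → t (suc i) j) m) n ∎

  module _ {p} {P : Pred ℕ p} (P? : Decidable P) where

    restrict : (ℕ → Carrier) → ℕ → Carrier
    restrict t j with P? j
    ... | yes _ = t j
    ... | no  _ = ε

    foldr-map-filter : ∀ (t : ℕ → Carrier) xs →
      foldr _∙_ ε (map t (filter P? xs)) ≈ foldr _∙_ ε (map (restrict t) xs)
    foldr-map-filter t []       = refl
    foldr-map-filter t (x ∷ xs) with P? x
    ... | yes _ = ∙-congˡ (foldr-map-filter t xs)
    ... | no  _ = trans (foldr-map-filter t xs) (sym (identityˡ _))

module Divisibility where
  open import Data.Nat.Base
  open import Data.Nat.Properties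
  open import Data.Nat.Divisibility
  open import Data.Nat.DivMod using (m*n/n≡m; m/n<m; m≥n⇒m/n>0)
  open import Data.Nat.Primality using (Prime; prime⇒nonTrivial; prime⇒irreducible)
  open import Data.Nat.Coprimality using (Coprime; coprime-divisor)
  open import Relation.Nullary using (¬_)
  open import Relation.Binary.PropositionalEquality
  open import Data.Nat.Primality.Factorisation using (factorise)
  open import Data.Nat.ListAction using (product)
  open import Data.List.Base using ([]; _∷_)
  open import Data.List.Relation.Unary.All using (_∷_)
  open import Data.Product using (∃; _×_; _,_)
  open import Data.Sum using (inj₁; inj₂)
  open import Data.Empty using (⊥-elim)

  prime⇒2≤ : ∀ {p} → Prime p → 2 ≤ p
  prime⇒2≤ {p} p-prime = nonTrivial⇒n>1 p {{prime⇒nonTrivial p-prime}}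

  *-pres-1≤ : ∀ {m n} → 1 ≤ m → 1 ≤ n → 1 ≤ m * n
  *-pres-1≤ {suc _} {suc _} _ _ = s≤s z≤n

  ^-pres-1≤ : ∀ {p} → 1 ≤ p → ∀ i → 1 ≤ p ^ i
  ^-pres-1≤ {suc p} _ i = m^n>0 (suc p) i

  divisor-positive : ∀ {e m} → 1 ≤ m → e ∣ m → 1 ≤ e
  divisor-positive {zero} 1≤m (divides-refl q) = ⊥-elim (<⇒≱ 1≤m (≤-reflexive (*-zeroʳ q)))
  divisor-positive {suc _} _ _ = s≤s z≤n

  quotient-bounds : ∀ {d n} .{{_ : NonZero d}} → 2 ≤ d → 1 ≤ n → d ∣ n → 1 ≤ n / d × n / d < n
  quotient-bounds {d} {n@(suc _)} 2≤d 1≤n d∣n = m≥n⇒m/n>0 (∣⇒≤ d∣n) , m/n<m n d 2≤d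

  p^i∣p^a : ∀ p {i a} → i ≤ a → p ^ i ∣ p ^ a
  p^i∣p^a p {i} {a} i≤a = subst (λ k → p ^ i ∣ p ^ k) (m+[n∸m]≡n i≤a)
    (subst (p ^ i ∣_) (sym (^-distribˡ-+-* p i (a ∸ i))) (m∣m*n (p ^ (a ∸ i))))

  coprime-^ : ∀ {p} → Prime p → ∀ {e} → ¬ p ∣ e → ∀ i → Coprime (p ^ i) e
  coprime-^ p-prime p∤e zero    (d∣1 , _)   = ∣1⇒≡1 d∣1
  coprime-^ {p} p-prime p∤e (suc i) {d} (d∣p^1+i , d∣e) =
    coprime-^ p-prime p∤e i (coprime-divisor d⊥p d∣p^1+i , d∣e)
    where
    d⊥p : Coprime d p
    d⊥p (c∣d , c∣p) with prime⇒irreducible p-prime c∣p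
    ... | inj₁ c≡1 = c≡1
    ... | inj₂ refl = ⊥-elim (p∤e (∣-trans c∣d d∣e))

  prime∤prime : ∀ {p q} → Prime p → Prime q → p ≢ q → ¬ p ∣ q
  prime∤prime p-prime q-prime p≢q p∣q with prime⇒irreducible q-prime p∣q
  ... | inj₁ refl = <⇒≱ (prime⇒2≤ p-prime) ≤-refl
  ... | inj₂ p≡q  = p≢q p≡q

  prime-factor : ∀ {n} → 2 ≤ n → ∃ λ p → Prime p × p ∣ n
  prime-factor {1} (s≤s ())
  prime-factor {n@(suc (suc _))} _ with factorise n
  ... | record { factors = [] ; isFactorisation = () }
  ... | record { factors = p ∷ ps ; isFactorisation = n≡p*∏ps ; factorsPrime = p-prime ∷ _ } =
    p , p-prime , subst (p ∣_) (sym n≡p*∏ps) (m∣m*n (product ps))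

  infixl 7 _÷_
  _÷_ : ℕ → ℕ → ℕ
  n ÷ zero  = 0
  n ÷ suc d = n / suc d

  m*n÷n≡m : ∀ m {n} → 1 ≤ n → m * n ÷ n ≡ m
  m*n÷n≡m m {suc n} _ = m*n/n≡m m (suc n)

  ÷≡quotient : ∀ {e m} → 1 ≤ e → (e∣m : e ∣ m) → m ÷ e ≡ quotient e∣m
  ÷≡quotient 1≤e (divides-refl q) = m*n÷n≡m q 1≤e

  p^a*m÷p^i*e : ∀ {p} → 1 ≤ p → ∀ {a i e m} → i ≤ a → 1 ≤ e → e ∣ m →
                p ^ a * m ÷ (p ^ i * e) ≡ p ^ (a ∸ i) * (m ÷ e)
  p^a*m÷p^i*e {p} 1≤p {a} {i} {e} i≤a 1≤e (divides-refl q) = begin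
    p ^ a * (q * e) ÷ (p ^ i * e)
      ≡⟨ cong (λ k → p ^ k * (q * e) ÷ (p ^ i * e)) (m∸n+n≡m i≤a) ⟨
    p ^ (a ∸ i + i) * (q * e) ÷ (p ^ i * e)
      ≡⟨ cong (λ x → x * (q * e) ÷ (p ^ i * e)) (^-distribˡ-+-* p (a ∸ i) i) ⟩
    p ^ (a ∸ i) * p ^ i * (q * e) ÷ (p ^ i * e)
      ≡⟨ cong (_÷ (p ^ i * e)) (interchange (p ^ (a ∸ i)) (p ^ i) q e) ⟩
    p ^ (a ∸ i) * q * (p ^ i * e) ÷ (p ^ i * e)
      ≡⟨ m*n÷n≡m (p ^ (a ∸ i) * q) (*-pres-1≤ (^-pres-1≤ 1≤p i) 1≤e) ⟩
    p ^ (a ∸ i) * q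
      ≡⟨ cong (p ^ (a ∸ i) *_) (m*n÷n≡m q 1≤e) ⟨
    p ^ (a ∸ i) * (q * e ÷ e) ∎
    where
    open ≡-Reasoning
    open import Algebra.Properties.CommutativeSemigroup *-commutativeSemigroup using (interchange)

  cofactor-÷ : ∀ {e m} → 1 ≤ e → 1 ≤ m → e ∣ m → 1 ≤ m ÷ e × m ÷ e ∣ m
  cofactor-÷ 1≤e 1≤m e∣m@(divides-refl q) rewrite ÷≡quotient 1≤e e∣m = positive q 1≤m , m∣m*n _
    where
    positive : ∀ q {e} → 1 ≤ q * e → 1 ≤ q
    positive (suc _) _ = s≤s z≤n

module Valuation where
  open import Data.Nat.Base
  open import Data.Nat.Properties
  open import Data.Nat.Divisibility
  open import Data.Nat.DivMod using (m*n/n≡m)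
  open import Data.Nat.Induction using (<-rec)
  open import Data.Nat.Primality using (Prime; prime⇒nonZero)
  open import Data.Nat.Coprimality using (coprime-divisor)
  import Data.Nat.Coprimality as Coprime
  open import Relation.Nullary using (yes; no; ¬_)
  open import Relation.Binary.PropositionalEquality
  open import Data.Product using (_×_; _,_; proj₁; proj₂)
  open import Data.Empty using (⊥-elim)
  open import Function using (_∘_)
  open Divisibility

  -- `ν p n` runs `νAux` with fuel `n`, which no longer matches the argument after a division by `p`.
  νAux-fuel : ∀ {p} → 2 ≤ p → ∀ k k′ n → 1 ≤ n → n ≤ k → n ≤ k′ → νAux k p n ≡ νAux k′ p n
  νAux-fuel _ _ _ zero () _ _
  νAux-fuel _ zero _ (suc _) _ () _
  νAux-fuel _ (suc _) zero (suc _) _ _ ()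
  νAux-fuel {p} 2≤p@(s≤s (s≤s z≤n)) (suc k) (suc k′) n 1≤n n≤1+k n≤1+k′ with p ∣? n
  ... | no  _   = refl
  ... | yes p∣n = cong suc (νAux-fuel 2≤p k k′ (n / p) 1≤n/p (shrink n≤1+k) (shrink n≤1+k′))
    where
    1≤n/p = proj₁ (quotient-bounds 2≤p 1≤n p∣n)
    shrink : ∀ {j} → n ≤ suc j → n / p ≤ j
    shrink n≤1+j = ≤-pred (≤-trans (proj₂ (quotient-bounds 2≤p 1≤n p∣n)) n≤1+j)

  ν[p*x]≡1+ν[x] : ∀ {p} → 2 ≤ p → ∀ x → 1 ≤ x → ν p (p * x) ≡ suc (ν p x)
  ν[p*x]≡1+ν[x] {p} 2≤p@(s≤s (s≤s z≤n)) x@(suc _) 1≤x with p ∣? (p * x)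
  ... | no  p∤p*x = ⊥-elim (p∤p*x (m∣m*n x))
  ... | yes _     = cong suc (trans (cong (νAux (pred (p * x)) p) p*x/p≡x)
                                    (νAux-fuel 2≤p (pred (p * x)) x x 1≤x x≤p*x-1 ≤-refl))
    where
    p*x/p≡x : p * x / p ≡ x
    p*x/p≡x = trans (cong (_/ p) (*-comm p x)) (m*n/n≡m x p)
    x≤p*x-1 : x ≤ pred (p * x)
    x≤p*x-1 = ≤-pred (subst (x <_) (*-comm x p) (m<m*n x p 2≤p))

  ∤⇒ν≡0 : ∀ {p n} → 2 ≤ p → ¬ p ∣ n → ν p n ≡ 0
  ∤⇒ν≡0 {n = zero}      _                 _   = refl
  ∤⇒ν≡0 {p} {n@(suc _)} (s≤s (s≤s z≤n)) p∤n with p ∣? n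
  ... | yes p∣n = ⊥-elim (p∤n p∣n)
  ... | no  _   = refl

  ν[p^i*y]≡i : ∀ {p y} → 2 ≤ p → 1 ≤ y → ¬ p ∣ y → ∀ i → ν p (p ^ i * y) ≡ i
  ν[p^i*y]≡i {p} {y} 2≤p 1≤y p∤y zero    = trans (cong (ν p) (*-identityˡ y)) (∤⇒ν≡0 2≤p p∤y)
  ν[p^i*y]≡i {p} {y} 2≤p 1≤y p∤y (suc i) = begin
    ν p (p * p ^ i * y)   ≡⟨ cong (ν p) (*-assoc p (p ^ i) y) ⟩
    ν p (p * (p ^ i * y)) ≡⟨ ν[p*x]≡1+ν[x] 2≤p (p ^ i * y) (*-pres-1≤ (^-pres-1≤ (<⇒≤ 2≤p) i) 1≤y) ⟩
    suc (ν p (p ^ i * y)) ≡⟨ cong suc (ν[p^i*y]≡i 2≤p 1≤y p∤y i) ⟩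
    suc i                 ∎
    where open ≡-Reasoning

  <⇒ν≡0 : ∀ {q k} → 2 ≤ q → 1 ≤ k → k < q → ν q k ≡ 0
  <⇒ν≡0 {q} {k} 2≤q 1≤k k<q = ∤⇒ν≡0 2≤q (λ q∣k → <⇒≱ k<q (∣⇒≤ {{>-nonZero 1≤k}} q∣k))

  record PrimePowerSplit (p n : ℕ) : Set where
    field
      exponent cofactor : ℕ
      1≤cofactor        : 1 ≤ cofactor
      p∤cofactor        : ¬ p ∣ cofactor
      n≡p^exponent*cofactor : n ≡ p ^ exponent * cofactor

  primePowerSplit : ∀ {p} → 2 ≤ p → ∀ n → 1 ≤ n → PrimePowerSplit p n
  primePowerSplit {p} 2≤p = <-rec (λ n → 1 ≤ n → PrimePowerSplit p n) step
    where
    step : ∀ n → (∀ {m} → m < n → 1 ≤ m → PrimePowerSplit p m) → 1 ≤ n → PrimePowerSplit p n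
    step n rec 1≤n with p ∣? n
    ... | no p∤n = record { exponent = 0 ; cofactor = n ; 1≤cofactor = 1≤n ; p∤cofactor = p∤n
                          ; n≡p^exponent*cofactor = sym (*-identityˡ n) }
    ... | yes p∣n = record { PrimePowerSplit split
                           ; exponent = suc exponent
                           ; n≡p^exponent*cofactor = n≡p*p^exponent*cofactor }
      where
      instance
        _ = n>1⇒nonTrivial 2≤p
        _ = >-nonZero 1≤n
      split = rec (quotient-< p∣n) (>-nonZero⁻¹ _ {{quotient≢0 p∣n}})
      open PrimePowerSplit split
      n≡p*p^exponent*cofactor : n ≡ p * p ^ exponent * cofactor
      n≡p*p^exponent*cofactor = begin
        n                               ≡⟨ m∣n⇒n≡m*quotient p∣n ⟩
        p * quotient p∣n                ≡⟨ cong (p *_) n≡p^exponent*cofactor ⟩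
        p * (p ^ exponent * cofactor)   ≡⟨ *-assoc p (p ^ exponent) cofactor ⟨
        p * p ^ exponent * cofactor     ∎
        where open ≡-Reasoning

  p^i*x-injective : ∀ {p i j x y} → 2 ≤ p → 1 ≤ x → 1 ≤ y → ¬ p ∣ x → ¬ p ∣ y →
                    p ^ i * x ≡ p ^ j * y → i ≡ j × x ≡ y
  p^i*x-injective {p} {i} {j} {x} {y} 2≤p 1≤x 1≤y p∤x p∤y eq = i≡j , x≡y
    where
    i≡j : i ≡ j
    i≡j = trans (sym (ν[p^i*y]≡i 2≤p 1≤x p∤x i)) (trans (cong (ν p) eq) (ν[p^i*y]≡i 2≤p 1≤y p∤y j))
    x≡y : x ≡ y
    x≡y = *-cancelˡ-≡ x y (p ^ i) {{>-nonZero (^-pres-1≤ (<⇒≤ 2≤p) i)}}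
                      (trans eq (cong (λ k → p ^ k * y) (sym i≡j)))

  ν[p^j*k]≡ν[k] : ∀ {p q} → Prime p → Prime q → q ≢ p → ∀ j {k} → 1 ≤ k → ν q (p ^ j * k) ≡ ν q k
  ν[p^j*k]≡ν[k] {p} {q} p-prime q-prime q≢p j {k} 1≤k = begin
    ν q (p ^ j * k)             ≡⟨ cong (λ k → ν q (p ^ j * k)) n≡p^exponent*cofactor ⟩
    ν q (p ^ j * (q ^ i * y))   ≡⟨ cong (ν q) (x∙yz≈y∙xz (p ^ j) (q ^ i) y) ⟩
    ν q (q ^ i * (p ^ j * y))   ≡⟨ ν[p^i*y]≡i 2≤q (*-pres-1≤ (^-pres-1≤ 1≤p j) 1≤cofactor) q∤p^j*y i ⟩
    i                           ≡⟨ ν[p^i*y]≡i 2≤q 1≤cofactor p∤cofactor i ⟨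
    ν q (q ^ i * y)             ≡⟨ cong (ν q) n≡p^exponent*cofactor ⟨
    ν q k                       ∎
    where
    open ≡-Reasoning
    open import Algebra.Properties.CommutativeSemigroup *-commutativeSemigroup using (x∙yz≈y∙xz)
    2≤q = prime⇒2≤ q-prime
    1≤p = <⇒≤ (prime⇒2≤ p-prime)
    open PrimePowerSplit (primePowerSplit 2≤q k 1≤k) renaming (exponent to i; cofactor to y)
    q∤p^j*y : ¬ q ∣ p ^ j * y
    q∤p^j*y q∣p^j*y = p∤cofactor
      (coprime-divisor (Coprime.sym (coprime-^ p-prime (prime∤prime p-prime q-prime (q≢p ∘ sym)) j)) q∣p^j*y)

  p^i*y∣p^a*m⇒i≤a×y∣m : ∀ {p m y} → Prime p → ¬ p ∣ m → ¬ p ∣ y →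
                         ∀ i a → p ^ i * y ∣ p ^ a * m → i ≤ a × y ∣ m
  p^i*y∣p^a*m⇒i≤a×y∣m {p} {m} {y} p-prime p∤m p∤y i a d∣n = i≤a , y∣m
    where
    y∣m : y ∣ m
    y∣m = coprime-divisor (Coprime.sym (coprime-^ p-prime p∤y a)) (∣-trans (n∣m*n (p ^ i)) d∣n)
    i≤a : i ≤ a
    i≤a with i ≤? a
    ... | yes i≤a = i≤a
    ... | no  i≰a = ⊥-elim (p∤m (*-cancelˡ-∣ (p ^ a) {{m^n≢0 p a {{prime⇒nonZero p-prime}}}} p^a*p∣p^a*m))
      where
      p^a*p∣p^a*m : p ^ a * p ∣ p ^ a * m
      p^a*p∣p^a*m = subst (_∣ p ^ a * m) (*-comm p (p ^ a))
                      (∣-trans (p^i∣p^a p (≰⇒> i≰a)) (∣-trans (m∣m*n y) d∣n))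

module PrimeFold {c ℓ : Level} (M : CommutativeMonoid c ℓ) where
  open import Data.Nat.Base using (zero; suc; _+_; _*_; _∸_; _<_; z≤n; s≤s; >-nonZero)
  open import Data.Nat.Properties
    using (_≟_; <⇒≤; m+[n∸m]≡n; ≤-trans; ≤-reflexive; ≤-<-trans; m≤m*n; m≤n*m; *-assoc; *-identityˡ)
  open import Data.Nat.Divisibility using (_∣_; ∣⇒≤; ∣-trans)
  open import Data.Nat.Primality using (prime?)
  open import Data.List.Base using (map; foldr; upTo)
  open import Relation.Nullary using (yes; no; ¬_)
  open import Relation.Binary.PropositionalEquality using (_≢_; cong; cong₂) renaming (refl to ≡-refl; sym to ≡-sym)
  open import Data.Empty using (⊥-elim)
  open CommutativeMonoid M
  open import Relation.Binary.Reasoning.Setoid setoid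
  open RangeFold M
  open Divisibility
  open Valuation

  foldPrimes : (ℕ → Carrier) → ℕ → Carrier
  foldPrimes ψ N = foldr _∙_ ε (map ψ (primesUpTo N))

  onPrimes : (ℕ → Carrier) → ℕ → Carrier
  onPrimes = restrict prime?

  foldPrimes≈Σ< : ∀ ψ N → foldPrimes ψ N ≈ Σ< (onPrimes ψ) (suc N)
  foldPrimes≈Σ< ψ N = trans (foldr-map-filter prime? ψ (upTo (suc N))) (reflexive (foldr-map-upTo _ (suc N)))

  onPrimes-cong : ∀ {ψ χ} → (∀ q → Prime q → ψ q ≈ χ q) → ∀ j → onPrimes ψ j ≈ onPrimes χ j
  onPrimes-cong ψ≈χ j with prime? j
  ... | yes j-prime = ψ≈χ j j-prime
  ... | no  _       = refl

  onPrimes-ε : ∀ ψ j → (Prime j → ψ j ≈ ε) → onPrimes ψ j ≈ ε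
  onPrimes-ε ψ j ψ≈ε with prime? j
  ... | yes j-prime = ψ≈ε j-prime
  ... | no  _       = refl

  onPrimes-∙ : ∀ ψ χ j → onPrimes (λ q → ψ q ∙ χ q) j ≈ onPrimes ψ j ∙ onPrimes χ j
  onPrimes-∙ ψ χ j with prime? j
  ... | yes _ = refl
  ... | no  _ = sym (identityˡ ε)

  foldPrimes-cong : ∀ {ψ χ} N → (∀ q → Prime q → ψ q ≈ χ q) → foldPrimes ψ N ≈ foldPrimes χ N
  foldPrimes-cong {ψ} {χ} N ψ≈χ = begin
    foldPrimes ψ N            ≈⟨ foldPrimes≈Σ< ψ N ⟩
    Σ< (onPrimes ψ) (suc N)   ≈⟨ Σ<-cong {onPrimes ψ} {onPrimes χ} (suc N) (λ j _ → onPrimes-cong ψ≈χ j) ⟩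
    Σ< (onPrimes χ) (suc N)   ≈⟨ foldPrimes≈Σ< χ N ⟨
    foldPrimes χ N            ∎

  foldPrimes-ε : ∀ ψ N → (∀ q → Prime q → ψ q ≈ ε) → foldPrimes ψ N ≈ ε
  foldPrimes-ε ψ N ψ≈ε =
    trans (foldPrimes≈Σ< ψ N) (Σ<-ε (onPrimes ψ) (suc N) (λ j _ → onPrimes-ε ψ j (ψ≈ε j)))

  foldPrimes-∙ : ∀ ψ χ N → foldPrimes (λ q → ψ q ∙ χ q) N ≈ foldPrimes ψ N ∙ foldPrimes χ N
  foldPrimes-∙ ψ χ N = begin
    foldPrimes (λ q → ψ q ∙ χ q) N
      ≈⟨ foldPrimes≈Σ< _ N ⟩
    Σ< (onPrimes (λ q → ψ q ∙ χ q)) (suc N)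
      ≈⟨ Σ<-cong {onPrimes (λ q → ψ q ∙ χ q)} (suc N) (λ j _ → onPrimes-∙ ψ χ j) ⟩
    Σ< (λ j → onPrimes ψ j ∙ onPrimes χ j) (suc N)
      ≈⟨ Σ<-∙ (onPrimes ψ) (onPrimes χ) (suc N) ⟩
    Σ< (onPrimes ψ) (suc N) ∙ Σ< (onPrimes χ) (suc N)
      ≈⟨ ∙-cong (foldPrimes≈Σ< ψ N) (foldPrimes≈Σ< χ N) ⟨
    foldPrimes ψ N ∙ foldPrimes χ N ∎

  foldPrimes-shrink : ∀ χ {K N} → K ≤ N → (∀ q → Prime q → K < q → χ q ≈ ε) →
    foldPrimes χ N ≈ foldPrimes χ K
  foldPrimes-shrink χ {K} {N} K≤N χ≈ε = begin
    foldPrimes χ N                              ≈⟨ foldPrimes≈Σ< χ N ⟩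
    Σ< (onPrimes χ) (suc N)                     ≡⟨ cong (Σ< (onPrimes χ)) (≡-sym (m+[n∸m]≡n (s≤s K≤N))) ⟩
    Σ< (onPrimes χ) (suc K + (suc N ∸ suc K))   ≈⟨ Σ<-extend (onPrimes χ) (suc K) (suc N ∸ suc K) vanishes ⟩
    Σ< (onPrimes χ) (suc K)                     ≈⟨ foldPrimes≈Σ< χ K ⟨
    foldPrimes χ K                              ∎
    where
    vanishes : ∀ j → suc K ≤ j → j < suc K + (suc N ∸ suc K) → onPrimes χ j ≈ ε
    vanishes j K<j _ = onPrimes-ε χ j (λ j-prime → χ≈ε j j-prime K<j)

  foldPrimes-single : ∀ ψ {N p} → Prime p → p ≤ N → (∀ q → Prime q → q ≢ p → ψ q ≈ ε) →
    foldPrimes ψ N ≈ ψ p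
  foldPrimes-single ψ {N} {p} p-prime p≤N ψ≈ε = begin
    foldPrimes ψ N            ≈⟨ foldPrimes≈Σ< ψ N ⟩
    Σ< (onPrimes ψ) (suc N)   ≈⟨ Σ<-single (onPrimes ψ) (suc N) p (s≤s p≤N) vanishes ⟩
    onPrimes ψ p              ≈⟨ onPrimes-prime ⟩
    ψ p                       ∎
    where
    vanishes : ∀ j → j < suc N → j ≢ p → onPrimes ψ j ≈ ε
    vanishes j _ j≢p = onPrimes-ε ψ j (λ j-prime → ψ≈ε j j-prime j≢p)
    onPrimes-prime : onPrimes ψ p ≈ ψ p
    onPrimes-prime with prime? p
    ... | yes _        = refl
    ... | no  ¬p-prime = ⊥-elim (¬p-prime p-prime)

  foldPrimes-localise : ∀ ψ χ A {p K N} → Prime p → p ≤ N → K ≤ N →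
    ψ p ≈ A ∙ χ p → (∀ q → Prime q → q ≢ p → ψ q ≈ χ q) →
    (∀ q → Prime q → K < q → χ q ≈ ε) → foldPrimes ψ N ≈ A ∙ foldPrimes χ K
  foldPrimes-localise ψ χ A {p} {K} {N} p-prime p≤N K≤N ψp≈A∙χp ψ≈χ χ≈ε = begin
    foldPrimes ψ N
      ≈⟨ foldPrimes-cong N ψ≈α∙χ ⟩
    foldPrimes (λ q → α q ∙ χ q) N
      ≈⟨ foldPrimes-∙ α χ N ⟩
    foldPrimes α N ∙ foldPrimes χ N
      ≈⟨ ∙-cong (foldPrimes-single α p-prime p≤N α≈ε) (foldPrimes-shrink χ K≤N χ≈ε) ⟩
    α p ∙ foldPrimes χ K
      ≈⟨ ∙-congʳ αp≈A ⟩
    A ∙ foldPrimes χ K ∎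
    where
    α : ℕ → Carrier
    α q with q ≟ p
    ... | yes _ = A
    ... | no  _ = ε
    αp≈A : α p ≈ A
    αp≈A with p ≟ p
    ... | yes _   = refl
    ... | no  p≢p = ⊥-elim (p≢p ≡-refl)
    α≈ε : ∀ q → Prime q → q ≢ p → α q ≈ ε
    α≈ε q _ q≢p with q ≟ p
    ... | yes q≡p = ⊥-elim (q≢p q≡p)
    ... | no  _   = refl
    ψ≈α∙χ : ∀ q → Prime q → ψ q ≈ α q ∙ χ q
    ψ≈α∙χ q q-prime with q ≟ p
    ... | yes ≡-refl = ψp≈A∙χp
    ... | no  q≢p    = trans (ψ≈χ q q-prime q≢p) (sym (identityˡ (χ q)))

  foldPrimes-ν-split : (φ : ℕ → ℕ → ℕ → Carrier) → (∀ q → φ q 0 0 ≈ ε) →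
    ∀ {p m e a i} → Prime p → 1 ≤ m → ¬ p ∣ m → e ∣ m → i ≤ a →
    foldPrimes (λ q → φ q (ν q (p ^ a * m)) (ν q (p ^ i * e))) (p ^ a * m)
      ≈ φ p a i ∙ foldPrimes (λ q → φ q (ν q m) (ν q e)) m
  foldPrimes-ν-split φ φ00≈ε {p} {m} {e} {zero} p-prime 1≤m p∤m e∣m z≤n
    rewrite *-identityˡ m | *-identityˡ e = trans (sym (identityˡ _)) (∙-congʳ (sym (φ00≈ε p)))
  foldPrimes-ν-split φ φ00≈ε {p} {m} {e} {a@(suc a′)} {i} p-prime 1≤m p∤m e∣m i≤a =
    foldPrimes-localise _ _ (φ p a i) p-prime p≤p^a*m m≤p^a*m at-p away-from-p above-m
    where
    2≤p = prime⇒2≤ p-prime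
    1≤p = <⇒≤ 2≤p
    1≤e = divisor-positive 1≤m e∣m
    p∤e : ¬ p ∣ e
    p∤e p∣e = p∤m (∣-trans p∣e e∣m)
    p≤p^a*m : p ≤ p ^ a * m
    p≤p^a*m = ≤-trans (m≤m*n p (p ^ a′ * m) {{>-nonZero (*-pres-1≤ (^-pres-1≤ 1≤p a′) 1≤m)}})
                      (≤-reflexive (≡-sym (*-assoc p (p ^ a′) m)))
    m≤p^a*m : m ≤ p ^ a * m
    m≤p^a*m = m≤n*m m (p ^ a) {{>-nonZero (^-pres-1≤ 1≤p a)}}
    at-p : φ p (ν p (p ^ a * m)) (ν p (p ^ i * e)) ≈ φ p a i ∙ φ p (ν p m) (ν p e)
    at-p = begin
      φ p (ν p (p ^ a * m)) (ν p (p ^ i * e)) ≡⟨ cong₂ (φ p) (ν[p^i*y]≡i 2≤p 1≤m p∤m a)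
                                                             (ν[p^i*y]≡i 2≤p 1≤e p∤e i) ⟩
      φ p a i                                 ≈⟨ identityʳ _ ⟨
      φ p a i ∙ ε                             ≈⟨ ∙-congˡ (φ00≈ε p) ⟨
      φ p a i ∙ φ p 0 0                       ≡⟨ cong₂ (λ x y → φ p a i ∙ φ p x y) (∤⇒ν≡0 2≤p p∤m)
                                                                                (∤⇒ν≡0 2≤p p∤e) ⟨
      φ p a i ∙ φ p (ν p m) (ν p e)           ∎
    away-from-p : ∀ q → Prime q → q ≢ p →
      φ q (ν q (p ^ a * m)) (ν q (p ^ i * e)) ≈ φ q (ν q m) (ν q e)
    away-from-p q q-prime q≢p = reflexive (cong₂ (φ q) (ν[p^j*k]≡ν[k] p-prime q-prime q≢p a 1≤m)
                                                       (ν[p^j*k]≡ν[k] p-prime q-prime q≢p i 1≤e))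
    above-m : ∀ q → Prime q → m < q → φ q (ν q m) (ν q e) ≈ ε
    above-m q q-prime m<q =
      trans (reflexive (cong₂ (φ q) (<⇒ν≡0 2≤q 1≤m m<q) (<⇒ν≡0 2≤q 1≤e e<q))) (φ00≈ε q)
      where
      2≤q = prime⇒2≤ q-prime
      e<q = ≤-<-trans (∣⇒≤ {{>-nonZero 1≤m}} e∣m) m<q

module DivisorSum {c ℓ : Level} (R : CommutativeRing c ℓ) where
  open import Data.Nat.Base using (zero; suc; _<_; z≤n; s≤s; pred; >-nonZero)
  import Data.Nat.Base as ℕ
  open import Data.Nat.Properties using (_≟_; <⇒≤; ≤-pred; suc-injective; suc-pred)
  open import Data.Nat.Divisibility using (_∣_; _∣?_; ∣⇒≤; ∣-trans; *-pres-∣)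
  open import Data.Product using (proj₁; proj₂)
  open import Relation.Nullary using (yes; no; ¬_; Dec)
  open import Relation.Binary.PropositionalEquality using (_≡_; _≢_; cong; subst)
    renaming (sym to ≡-sym; trans to ≡-trans)
  open import Data.Empty using (⊥; ⊥-elim)
  open CommutativeRing R
  open import Relation.Binary.Reasoning.Setoid setoid
  open RangeFold +-commutativeMonoid
  open Divisibility
  open Valuation

  Σ<-distribˡ : ∀ x (t : ℕ → Carrier) n → x * Σ< t n ≈ Σ< (λ j → x * t j) n
  Σ<-distribˡ x t zero    = zeroʳ x
  Σ<-distribˡ x t (suc n) = trans (distribˡ x (t 0) _) (+-congˡ (Σ<-distribˡ x (λ j → t (suc j)) n))

  Σ<-distribʳ : ∀ x (t : ℕ → Carrier) n → Σ< t n * x ≈ Σ< (λ j → t j * x) n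
  Σ<-distribʳ x t n = trans (*-comm _ x) (trans (Σ<-distribˡ x t n) (Σ<-cong n (λ j _ → *-comm x (t j))))

  -- As in `Defs.dirichlet`, the summation index `k` stands for the candidate divisor `k + 1`.
  divisorTerm : ℕ → (ℕ → Carrier) → ℕ → Carrier
  divisorTerm n T k with suc k ∣? n
  ... | yes _ = T (suc k)
  ... | no  _ = 0#

  divisorSum : ℕ → (ℕ → Carrier) → Carrier
  divisorSum n T = Σ< (divisorTerm n T) n

  divisorTerm-∣ : ∀ n T k → suc k ∣ n → divisorTerm n T k ≈ T (suc k)
  divisorTerm-∣ n T k k+1∣n with suc k ∣? n
  ... | yes _       = refl
  ... | no  k+1∤n   = ⊥-elim (k+1∤n k+1∣n)

  divisorTerm-∤ : ∀ n T k → ¬ suc k ∣ n → divisorTerm n T k ≈ 0#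
  divisorTerm-∤ n T k k+1∤n with suc k ∣? n
  ... | yes k+1∣n = ⊥-elim (k+1∤n k+1∣n)
  ... | no  _     = refl

  divisorTerm-cong : ∀ n {T U} k → (suc k ∣ n → T (suc k) ≈ U (suc k)) →
    divisorTerm n T k ≈ divisorTerm n U k
  divisorTerm-cong n k T≈U with suc k ∣? n
  ... | yes k+1∣n = T≈U k+1∣n
  ... | no  _     = refl

  divisorSum-cong : ∀ n {T U} → (∀ d → 1 ≤ d → d ∣ n → T d ≈ U d) → divisorSum n T ≈ divisorSum n U
  divisorSum-cong n T≈U = Σ<-cong n (λ k _ → divisorTerm-cong n k (T≈U (suc k) (s≤s z≤n)))

  divisorSum-scale : ∀ n x T → divisorSum n (λ d → x * T d) ≈ x * divisorSum n T
  divisorSum-scale n x T = trans (Σ<-cong n termwise) (sym (Σ<-distribˡ x (divisorTerm n T) n))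
    where
    termwise : ∀ k → k < n → divisorTerm n (λ d → x * T d) k ≈ x * divisorTerm n T k
    termwise k _ with suc k ∣? n
    ... | yes _ = refl
    ... | no  _ = sym (zeroʳ x)

  module _ {p m} (p-prime : Prime p) (1≤m : 1 ≤ m) (p∤m : ¬ p ∣ m) (a : ℕ) (T : ℕ → Carrier) where
    private
      n = p ^ a ℕ.* m
      2≤p = prime⇒2≤ p-prime
      1≤n = *-pres-1≤ (^-pres-1≤ (<⇒≤ 2≤p) a) 1≤m

      -- Both sides of `divisorSum-p^a*m` are sums of this array, as `d = p^i e` with `i ≤ a`, `e ∣ m`
      -- runs through the divisors of `p^a m` exactly once.
      matched : ℕ → ℕ → ℕ → Carrier
      matched i e k with suc e ∣? m
      ... | no  _ = 0#
      ... | yes _ with suc k ≟ p ^ i ℕ.* suc e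
      ...   | yes _ = T (suc k)
      ...   | no  _ = 0#

      matched-hit : ∀ i e k → suc e ∣ m → suc k ≡ p ^ i ℕ.* suc e → matched i e k ≈ T (suc k)
      matched-hit i e k e+1∣m eq with suc e ∣? m
      ... | no  e+1∤m = ⊥-elim (e+1∤m e+1∣m)
      ... | yes _ with suc k ≟ p ^ i ℕ.* suc e
      ...   | yes _   = refl
      ...   | no  neq = ⊥-elim (neq eq)

      matched-miss : ∀ i e k → (suc e ∣ m → suc k ≡ p ^ i ℕ.* suc e → ⊥) → matched i e k ≈ 0#
      matched-miss i e k miss with suc e ∣? m
      ... | no  _ = refl
      ... | yes e+1∣m with suc k ≟ p ^ i ℕ.* suc e
      ...   | yes eq = ⊥-elim (miss e+1∣m eq)
      ...   | no  _  = refl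

      p^i*d∣n : ∀ {i d} → i < suc a → d ∣ m → p ^ i ℕ.* d ∣ n
      p^i*d∣n i<1+a d∣m = *-pres-∣ (p^i∣p^a p (≤-pred i<1+a)) d∣m

      pair-matched-once : ∀ i e → i < suc a →
        divisorTerm m (λ d → T (p ^ i ℕ.* d)) e ≈ Σ< (matched i e) n
      pair-matched-once i e i<1+a = by-cases (suc e ∣? m)
        where
        v = p ^ i ℕ.* suc e
        v≡1+[v-1] : suc (pred v) ≡ v
        v≡1+[v-1] = suc-pred v {{>-nonZero (*-pres-1≤ (^-pres-1≤ (<⇒≤ 2≤p) i) (s≤s z≤n))}}
        by-cases : Dec (suc e ∣ m) → divisorTerm m (λ d → T (p ^ i ℕ.* d)) e ≈ Σ< (matched i e) n
        by-cases (no e+1∤m) = trans (divisorTerm-∤ m _ e e+1∤m)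
          (sym (Σ<-ε _ n (λ k _ → matched-miss i e k (λ e+1∣m _ → e+1∤m e+1∣m))))
        by-cases (yes e+1∣m) = begin
          divisorTerm m (λ d → T (p ^ i ℕ.* d)) e ≈⟨ divisorTerm-∣ m _ e e+1∣m ⟩
          T v                                     ≡⟨ cong T v≡1+[v-1] ⟨
          T (suc (pred v))                        ≈⟨ matched-hit i e (pred v) e+1∣m v≡1+[v-1] ⟨
          matched i e (pred v)                    ≈⟨ Σ<-single _ n (pred v) v-1<n miss ⟨
          Σ< (matched i e) n                      ∎
          where
          v-1<n : pred v < n
          v-1<n = subst (_≤ n) (≡-sym v≡1+[v-1]) (∣⇒≤ {{>-nonZero 1≤n}} (p^i*d∣n i<1+a e+1∣m))
          miss : ∀ k → k < n → k ≢ pred v → matched i e k ≈ 0#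
          miss k _ k≢v-1 =
            matched-miss i e k (λ _ eq → k≢v-1 (suc-injective (≡-trans eq (≡-sym v≡1+[v-1]))))

      divisor-matched-once : ∀ k →
        Σ< (λ i → Σ< (λ e → matched i e k) m) (suc a) ≈ divisorTerm n T k
      divisor-matched-once k = by-cases (suc k ∣? n)
        where
        by-cases : Dec (suc k ∣ n) → Σ< (λ i → Σ< (λ e → matched i e k) m) (suc a) ≈ divisorTerm n T k
        by-cases (no k+1∤n) = trans
          (Σ<-ε _ (suc a) (λ i i<1+a → Σ<-ε _ m (λ e _ → matched-miss i e k
            (λ e+1∣m eq → k+1∤n (subst (_∣ n) (≡-sym eq) (p^i*d∣n i<1+a e+1∣m))))))
          (sym (divisorTerm-∤ n T k k+1∤n))
        by-cases (yes k+1∣n) = begin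
          Σ< (λ i → Σ< (λ e → matched i e k) m) (suc a)  ≈⟨ Σ<-single _ (suc a) exponent (s≤s i≤a) other-i ⟩
          Σ< (λ e → matched exponent e k) m               ≈⟨ Σ<-single _ m (pred cofactor) y-1<m other-e ⟩
          matched exponent (pred cofactor) k              ≈⟨ matched-hit exponent (pred cofactor) k y∣m′ k+1≡p^i*y ⟩
          T (suc k)                                       ≈⟨ divisorTerm-∣ n T k k+1∣n ⟨
          divisorTerm n T k                               ∎
          where
          open PrimePowerSplit (primePowerSplit 2≤p (suc k) (s≤s z≤n))
          i≤a×y∣m = p^i*y∣p^a*m⇒i≤a×y∣m p-prime p∤m p∤cofactor exponent a
                      (subst (_∣ n) n≡p^exponent*cofactor k+1∣n)
          i≤a = proj₁ i≤a×y∣m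
          y∣m = proj₂ i≤a×y∣m
          y≡1+[y-1] : cofactor ≡ suc (pred cofactor)
          y≡1+[y-1] = ≡-sym (suc-pred cofactor {{>-nonZero 1≤cofactor}})
          y∣m′ = subst (_∣ m) y≡1+[y-1] y∣m
          k+1≡p^i*y = ≡-trans n≡p^exponent*cofactor (cong (p ^ exponent ℕ.*_) y≡1+[y-1])
          y-1<m : pred cofactor < m
          y-1<m = subst (_≤ m) y≡1+[y-1] (∣⇒≤ {{>-nonZero 1≤m}} y∣m)
          unique : ∀ i e → suc e ∣ m → suc k ≡ p ^ i ℕ.* suc e → i ≡ exponent × suc e ≡ cofactor
          unique i e e+1∣m eq = p^i*x-injective 2≤p (s≤s z≤n) 1≤cofactor
            (λ p∣e+1 → p∤m (∣-trans p∣e+1 e+1∣m)) p∤cofactor (≡-trans (≡-sym eq) n≡p^exponent*cofactor)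
          other-i : ∀ i → i < suc a → i ≢ exponent → Σ< (λ e → matched i e k) m ≈ 0#
          other-i i _ i≢ =
            Σ<-ε _ m (λ e _ → matched-miss i e k (λ e+1∣m eq → i≢ (proj₁ (unique i e e+1∣m eq))))
          other-e : ∀ e → e < m → e ≢ pred cofactor → matched exponent e k ≈ 0#
          other-e e _ e≢ = matched-miss exponent e k
            (λ e+1∣m eq → e≢ (suc-injective (≡-trans (proj₂ (unique exponent e e+1∣m eq)) y≡1+[y-1])))

    divisorSum-p^a*m : divisorSum n T ≈ Σ< (λ i → divisorSum m (λ e → T (p ^ i ℕ.* e))) (suc a)
    divisorSum-p^a*m = begin
      Σ< (divisorTerm n T) n
        ≈⟨ Σ<-cong n (λ k _ → sym (divisor-matched-once k)) ⟩
      Σ< (λ k → Σ< (λ i → Σ< (λ e → matched i e k) m) (suc a)) n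
        ≈⟨ Σ<-swap (λ i k → Σ< (λ e → matched i e k) m) (suc a) n ⟨
      Σ< (λ i → Σ< (λ k → Σ< (λ e → matched i e k) m) n) (suc a)
        ≈⟨ Σ<-cong (suc a) (λ i _ → Σ<-swap (λ k e → matched i e k) n m) ⟩
      Σ< (λ i → Σ< (λ e → Σ< (matched i e) n) m) (suc a)
        ≈⟨ Σ<-cong (suc a) (λ i i<1+a → Σ<-cong m (λ e _ → pair-matched-once i e i<1+a)) ⟨
      Σ< (λ i → divisorSum m (λ e → T (p ^ i ℕ.* e))) (suc a) ∎

module Convolution {c ℓ : Level} (R : CommutativeRing c ℓ) where
  open import Data.Nat.Base using (zero; suc; _∸_; _<_; z≤n; s≤s)
  import Data.Nat.Base as ℕ
  open import Data.Nat.Properties using (<⇒≤; ≤-pred) renaming (*-identityˡ to ℕ-*-identityˡ)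
  open import Data.Nat.Divisibility using (_∣_; ∣-trans; 1∣_)
  open import Data.Nat.DivMod using (n/1≡n)
  open import Data.Nat.Induction using (<-rec)
  open import Data.Product using (_,_; proj₁; proj₂)
  open import Relation.Nullary using (¬_)
  open import Data.Empty using (⊥-elim)
  open import Relation.Binary.PropositionalEquality using (cong; subst) renaming (trans to ≡-trans)
  open CommutativeRing R
  open Arith R
  open import Relation.Binary.Reasoning.Setoid setoid
  open import Algebra.Properties.CommutativeSemigroup *-commutativeSemigroup using (interchange)
  open import Algebra.Properties.Group +-group using () renaming (∙-cancelʳ to +-cancelʳ)
  open RangeFold +-commutativeMonoid
  open DivisorSum R
  open Divisibility
  open Valuation

  convolutionTerm : (ℕ → ℕ → Carrier) → (ℕ → Carrier) → (ℕ → Carrier) → ℕ → ℕ → Carrier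
  convolutionTerm W f g n d = W n d * (f d * g (n ÷ d))

  convolution : (ℕ → ℕ → Carrier) → (ℕ → Carrier) → (ℕ → Carrier) → ℕ → Carrier
  convolution W f g n = divisorSum n (convolutionTerm W f g n)

  IsInverse : (ℕ → ℕ → Carrier) → (ℕ → Carrier) → (ℕ → Carrier) → Set ℓ
  IsInverse W f g = ∀ n → 1 ≤ n → convolution W f g n ≈ δ n

  convolution-head : ∀ W {f} g → f 1 ≈ 1# → ∀ n → W (suc n) 1 ≈ 1# →
    convolution W f g (suc n)
      ≈ g (suc n) + Σ< (λ k → divisorTerm (suc n) (convolutionTerm W f g (suc n)) (suc k)) n
  convolution-head W {f} g f1≈1 n W1≈1 = +-congʳ (begin
    divisorTerm (suc n) _ 0               ≈⟨ divisorTerm-∣ (suc n) _ 0 (1∣ suc n) ⟩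
    W (suc n) 1 * (f 1 * g (suc n ÷ 1))   ≈⟨ *-cong W1≈1 (*-congʳ f1≈1) ⟩
    1# * (1# * g (suc n ÷ 1))             ≈⟨ trans (*-identityˡ _) (*-identityˡ _) ⟩
    g (suc n ÷ 1)                         ≡⟨ cong g (n/1≡n (suc n)) ⟩
    g (suc n)                             ∎)

  inverse-unique : ∀ W {f g h} → f 1 ≈ 1# → (∀ n → W n 1 ≈ 1#) →
    IsInverse W f g → IsInverse W f h → ∀ n → 1 ≤ n → g n ≈ h n
  inverse-unique W {f} {g} {h} f1≈1 W·1≈1 g-inverse h-inverse = <-rec (λ n → 1 ≤ n → g n ≈ h n) step
    where
    step : ∀ n → (∀ {m} → m < n → 1 ≤ m → g m ≈ h m) → 1 ≤ n → g n ≈ h n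
    step (suc n) g≈h-below _ = +-cancelʳ (rest h) (g (suc n)) (h (suc n)) (begin
      g (suc n) + rest h          ≈⟨ +-congˡ (Σ<-cong n (λ k _ → divisorTerm-cong _ (suc k) proper-divisor)) ⟨
      g (suc n) + rest g          ≈⟨ convolution-head W g f1≈1 n (W·1≈1 (suc n)) ⟨
      convolution W f g (suc n)   ≈⟨ g-inverse (suc n) (s≤s z≤n) ⟩
      δ (suc n)                   ≈⟨ h-inverse (suc n) (s≤s z≤n) ⟨
      convolution W f h (suc n)   ≈⟨ convolution-head W h f1≈1 n (W·1≈1 (suc n)) ⟩
      h (suc n) + rest h          ∎)
      where
      rest : (ℕ → Carrier) → Carrier
      rest u = Σ< (λ k → divisorTerm (suc n) (convolutionTerm W f u (suc n)) (suc k)) n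
      proper-divisor : ∀ {k} → suc (suc k) ∣ suc n →
        convolutionTerm W f g (suc n) (suc (suc k)) ≈ convolutionTerm W f h (suc n) (suc (suc k))
      proper-divisor d∣n with quotient-bounds (s≤s (s≤s z≤n)) (s≤s z≤n) d∣n
      ... | 1≤n/d , n/d<n = *-congˡ (*-congˡ (g≈h-below n/d<n 1≤n/d))

  SplitsOffPrimePowers : (ℕ → Carrier) → (ℕ → ℕ → Carrier) → Set ℓ
  SplitsOffPrimePowers G Gp = ∀ {p k} j → Prime p → 1 ≤ k → ¬ p ∣ k → G (p ^ j ℕ.* k) ≈ Gp p j * G k

  SplitsOffPrimePowers₂ : (ℕ → ℕ → Carrier) → (ℕ → ℕ → ℕ → Carrier) → Set ℓ
  SplitsOffPrimePowers₂ W Wp = ∀ {p m e a i} → Prime p → 1 ≤ m → ¬ p ∣ m → e ∣ m → i ≤ a →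
    W (p ^ a ℕ.* m) (p ^ i ℕ.* e) ≈ Wp p a i * W m e

  localFactor : (ℕ → ℕ → ℕ → Carrier) → (ℕ → Carrier) → (ℕ → ℕ → Carrier) → ℕ → ℕ → Carrier
  localFactor Wp f Gp p a = Σ< (λ i → Wp p a i * (f (p ^ i) * Gp p (a ∸ i))) (suc a)

  module _ {W Wp f G Gp} (f-mult : Multiplicative f)
           (W-splits : SplitsOffPrimePowers₂ W Wp) (G-splits : SplitsOffPrimePowers G Gp) where

    convolution-p^a*m : ∀ {p m} → Prime p → 1 ≤ m → ¬ p ∣ m → ∀ a →
      convolution W f G (p ^ a ℕ.* m) ≈ localFactor Wp f Gp p a * convolution W f G m
    convolution-p^a*m {p} {m} p-prime 1≤m p∤m a = begin
      convolution W f G n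
        ≈⟨ divisorSum-p^a*m p-prime 1≤m p∤m a (T n) ⟩
      Σ< (λ i → divisorSum m (λ e → T n (p ^ i ℕ.* e))) (suc a)
        ≈⟨ Σ<-cong (suc a) (λ i i<1+a → divisorSum-cong m (term-splits (≤-pred i<1+a))) ⟩
      Σ< (λ i → divisorSum m (λ e → local i * T m e)) (suc a)
        ≈⟨ Σ<-cong (suc a) (λ i _ → divisorSum-scale m (local i) (T m)) ⟩
      Σ< (λ i → local i * convolution W f G m) (suc a)
        ≈⟨ Σ<-distribʳ (convolution W f G m) local (suc a) ⟨
      localFactor Wp f Gp p a * convolution W f G m ∎
      where
      n = p ^ a ℕ.* m
      T = convolutionTerm W f G
      local : ℕ → Carrier
      local i = Wp p a i * (f (p ^ i) * Gp p (a ∸ i))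
      term-splits : ∀ {i} → i ≤ a → ∀ e → 1 ≤ e → e ∣ m → T n (p ^ i ℕ.* e) ≈ local i * T m e
      term-splits {i} i≤a e 1≤e e∣m = begin
        W n (p ^ i ℕ.* e) * (f (p ^ i ℕ.* e) * G (n ÷ (p ^ i ℕ.* e)))
          ≈⟨ *-cong (W-splits p-prime 1≤m p∤m e∣m i≤a) (*-cong f-splits G-splits′) ⟩
        (Wp p a i * W m e) * ((f (p ^ i) * f e) * (Gp p (a ∸ i) * G (m ÷ e)))
          ≈⟨ *-congˡ (interchange _ _ _ _) ⟩
        (Wp p a i * W m e) * ((f (p ^ i) * Gp p (a ∸ i)) * (f e * G (m ÷ e)))
          ≈⟨ interchange _ _ _ _ ⟩
        local i * T m e ∎
        where
        2≤p = prime⇒2≤ p-prime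
        p∤e : ¬ p ∣ e
        p∤e p∣e = p∤m (∣-trans p∣e e∣m)
        f-splits : f (p ^ i ℕ.* e) ≈ f (p ^ i) * f e
        f-splits = proj₂ f-mult (p ^ i) e (^-pres-1≤ (<⇒≤ 2≤p) i) 1≤e (coprime-^ p-prime p∤e i)
        G-splits′ : G (n ÷ (p ^ i ℕ.* e)) ≈ Gp p (a ∸ i) * G (m ÷ e)
        G-splits′ = trans (reflexive (cong G (p^a*m÷p^i*e (<⇒≤ 2≤p) i≤a 1≤e e∣m)))
          (G-splits (a ∸ i) p-prime (proj₁ (cofactor-÷ 1≤e 1≤m e∣m))
            (λ p∣m÷e → p∤m (∣-trans p∣m÷e (proj₂ (cofactor-÷ 1≤e 1≤m e∣m)))))

    inverse-exists : W 1 1 ≈ 1# → G 1 ≈ 1# →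
      (∀ {p} a → Prime p → 1 ≤ a → localFactor Wp f Gp p a ≈ 0#) → IsInverse W f G
    inverse-exists W11≈1 G1≈1 local≈0 1 _ = begin
      divisorTerm 1 (convolutionTerm W f G 1) 0 + 0#  ≈⟨ +-identityʳ _ ⟩
      divisorTerm 1 (convolutionTerm W f G 1) 0       ≈⟨ divisorTerm-∣ 1 (convolutionTerm W f G 1) 0 (1∣ 1) ⟩
      W 1 1 * (f 1 * G 1)                             ≈⟨ *-cong W11≈1 (*-cong (proj₁ f-mult) G1≈1) ⟩
      1# * (1# * 1#)                                  ≈⟨ trans (*-identityˡ _) (*-identityˡ 1#) ⟩
      1#                                              ∎
    inverse-exists W11≈1 G1≈1 local≈0 n@(suc (suc _)) _ with prime-factor {n} (s≤s (s≤s z≤n))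
    ... | p , p-prime , p∣n = begin
      convolution W f G n
        ≡⟨ cong (convolution W f G) n≡p^exponent*cofactor ⟩
      convolution W f G (p ^ exponent ℕ.* cofactor)
        ≈⟨ convolution-p^a*m p-prime 1≤cofactor p∤cofactor exponent ⟩
      localFactor Wp f Gp p exponent * convolution W f G cofactor
        ≈⟨ *-congʳ (local≈0 exponent p-prime 1≤exponent) ⟩
      0# * convolution W f G cofactor
        ≈⟨ zeroˡ _ ⟩
      0# ∎
      where
      open PrimePowerSplit (primePowerSplit (prime⇒2≤ p-prime) n (s≤s z≤n))
      1≤exponent : 1 ≤ exponent
      1≤exponent with exponent | n≡p^exponent*cofactor
      ... | zero  | n≡1*cofactor =
        ⊥-elim (p∤cofactor (subst (p ∣_) (≡-trans n≡1*cofactor (ℕ-*-identityˡ cofactor)) p∣n))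
      ... | suc _ | _            = s≤s z≤n

module Inverses {c ℓ : Level} (R : CommutativeRing c ℓ) where
  open import Data.Nat.Base using (zero; suc; _!; _∸_; z≤n; s≤s)
  import Data.Nat.Base as ℕ
  import Data.Nat.Properties as ℕ
  open import Data.Nat.Combinatorics using (_C_; nC1≡n)
  open import Data.Nat.Divisibility using (_∣_; _∣?_; 1∣_)
  open import Data.List.Base using (upTo)
  open import Data.Product using (proj₁)
  open import Relation.Nullary using (yes; no; ¬_)
  open import Relation.Binary.PropositionalEquality using (_≡_; cong) renaming (refl to ≡-refl)
  open CommutativeRing R
  open Arith R
  open import Relation.Binary.Reasoning.Setoid setoid
  open import Algebra.Properties.CommutativeSemigroup *-commutativeSemigroup using (interchange)
  open import Algebra.Properties.Ring ring using (-1*x≈-x)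
  open RangeFold +-commutativeMonoid
  open DivisorSum R
  open Convolution R
  open Divisibility
  open Valuation
  module ℕ+ = PrimeFold ℕ.+-0-commutativeMonoid
  module ℕ* = PrimeFold ℕ.*-1-commutativeMonoid
  module R* = PrimeFold *-commutativeMonoid

  fromℕ-+ : ∀ a b → fromℕ (a ℕ.+ b) ≈ fromℕ a + fromℕ b
  fromℕ-+ zero    b = sym (+-identityˡ _)
  fromℕ-+ (suc a) b = trans (+-congˡ (fromℕ-+ a b)) (sym (+-assoc _ _ _))

  fromℕ-* : ∀ a b → fromℕ (a ℕ.* b) ≈ fromℕ a * fromℕ b
  fromℕ-* zero    b = sym (zeroˡ _)
  fromℕ-* (suc a) b = begin
    fromℕ (b ℕ.+ a ℕ.* b)                ≈⟨ fromℕ-+ b (a ℕ.* b) ⟩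
    fromℕ b + fromℕ (a ℕ.* b)            ≈⟨ +-cong (sym (*-identityˡ _)) (fromℕ-* a b) ⟩
    1# * fromℕ b + fromℕ a * fromℕ b     ≈⟨ distribʳ _ _ _ ⟨
    (1# + fromℕ a) * fromℕ b             ∎

  fromℕ-1 : fromℕ 1 ≈ 1#
  fromℕ-1 = +-identityʳ 1#

  pow-+ : ∀ x a b → pow x (a ℕ.+ b) ≈ pow x a * pow x b
  pow-+ x zero    b = sym (*-identityˡ _)
  pow-+ x (suc a) b = trans (*-congˡ (pow-+ x a b)) (sym (*-assoc _ _ _))

  Ω-split : ∀ {p k} → Prime p → 1 ≤ k → ¬ p ∣ k → ∀ j → Ω (p ^ j ℕ.* k) ≡ j ℕ.+ Ω k
  Ω-split p-prime 1≤k p∤k j =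
    ℕ+.foldPrimes-ν-split (λ _ v _ → v) (λ _ → ≡-refl) {a = j} p-prime 1≤k p∤k (1∣ _) z≤n

  ξ-split : ∀ {p k} → Prime p → 1 ≤ k → ¬ p ∣ k → ∀ j → ξ (p ^ j ℕ.* k) ≡ j ! ℕ.* ξ k
  ξ-split p-prime 1≤k p∤k j =
    ℕ*.foldPrimes-ν-split (λ _ v _ → v !) (λ _ → ≡-refl) {a = j} p-prime 1≤k p∤k (1∣ _) z≤n

  binomCoeff-split : ∀ {p m e a i} → Prime p → 1 ≤ m → ¬ p ∣ m → e ∣ m → i ≤ a →
    binomCoeff (p ^ a ℕ.* m) (p ^ i ℕ.* e) ≡ (a C i) ℕ.* binomCoeff m e
  binomCoeff-split = ℕ*.foldPrimes-ν-split (λ _ v w → v C w) (λ _ → ≡-refl)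

  binomCoeff[n,1] : ∀ n → binomCoeff n 1 ≡ 1
  binomCoeff[n,1] n = ℕ*.foldPrimes-ε _ n (λ q q-prime → cong (ν q n C_) (ν[1]≡0 (prime⇒2≤ q-prime)))
    where
    ν[1]≡0 : ∀ {q} → 2 ≤ q → ν q 1 ≡ 0
    ν[1]≡0 2≤q = <⇒ν≡0 2≤q (s≤s z≤n) 2≤q

  primePowProd-split : ∀ f {p k} → Prime p → 1 ≤ k → ¬ p ∣ k → ∀ j →
    primePowProd f (p ^ j ℕ.* k) ≈ pow (f p) j * primePowProd f k
  primePowProd-split f p-prime 1≤k p∤k j =
    R*.foldPrimes-ν-split (λ q v _ → pow (f q) v) (λ _ → refl) {a = j} p-prime 1≤k p∤k (1∣ _) z≤n

  alternating : (ℕ → Carrier) → (ℕ → Carrier) → ℕ → ℕ → Carrier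
  alternating c f p j = pow (- 1#) j * (c j * pow (f p) j)

  localFactor-vanishes : ∀ {f} → f 1 ≈ 1# → (∀ p a → Prime p → 2 ≤ a → f (p ^ a) ≈ 0#) →
    ∀ {Wp c} → (∀ p b → Wp p (suc b) 0 ≈ 1#) → (∀ p b → Wp p (suc b) 1 * c b ≈ c (suc b)) →
    ∀ {p} a → Prime p → 1 ≤ a → localFactor Wp f (alternating c f) p a ≈ 0#
  localFactor-vanishes {f} f1≈1 f-vanishes {Wp} {c} Wp0≈1 Wp1*c≈c {p} (suc b) p-prime _ = begin
    t 0 + (t 1 + Σ< (λ j → t (suc (suc j))) b)  ≈⟨ +-congˡ (trans (+-congˡ tail≈0) (+-identityʳ (t 1))) ⟩
    t 0 + t 1                                    ≈⟨ +-cong t0≈-1*Y t1≈Y ⟩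
    - 1# * Y + Y                                 ≈⟨ +-congʳ (-1*x≈-x Y) ⟩
    - Y + Y                                      ≈⟨ -‿inverseˡ Y ⟩
    0#                                           ∎
    where
    open import Algebra.Properties.CommutativeSemigroup *-commutativeSemigroup using (x∙yz≈y∙xz)
    t : ℕ → Carrier
    t i = Wp p (suc b) i * (f (p ^ i) * alternating c f p (suc b ∸ i))
    x = f p
    Y = pow (- 1#) b * (c (suc b) * (x * pow x b))
    tail≈0 : Σ< (λ j → t (suc (suc j))) b ≈ 0#
    tail≈0 = Σ<-ε _ b (λ j _ → trans (*-congˡ (trans (*-congʳ (f[p^2+j]≈0 j)) (zeroˡ _))) (zeroʳ _))
      where
      f[p^2+j]≈0 : ∀ j → f (p ^ suc (suc j)) ≈ 0#
      f[p^2+j]≈0 j = f-vanishes p (suc (suc j)) p-prime (s≤s (s≤s z≤n))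
    t0≈-1*Y : t 0 ≈ - 1# * Y
    t0≈-1*Y = begin
      Wp p (suc b) 0 * (f 1 * ((- 1# * pow (- 1#) b) * (c (suc b) * (x * pow x b))))
        ≈⟨ *-cong (Wp0≈1 p b) (*-congʳ f1≈1) ⟩
      1# * (1# * ((- 1# * pow (- 1#) b) * (c (suc b) * (x * pow x b))))
        ≈⟨ trans (*-identityˡ _) (*-identityˡ _) ⟩
      (- 1# * pow (- 1#) b) * (c (suc b) * (x * pow x b))
        ≈⟨ *-assoc _ _ _ ⟩
      - 1# * Y ∎
    t1≈Y : t 1 ≈ Y
    t1≈Y = begin
      Wp p (suc b) 1 * (f (p ℕ.* 1) * (pow (- 1#) b * (c b * pow x b)))
        ≈⟨ *-congˡ (*-congʳ (reflexive (cong f (ℕ.*-identityʳ p)))) ⟩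
      Wp p (suc b) 1 * (x * (pow (- 1#) b * (c b * pow x b)))
        ≈⟨ *-congˡ (x∙yz≈y∙xz _ _ _) ⟩
      Wp p (suc b) 1 * (pow (- 1#) b * (x * (c b * pow x b)))
        ≈⟨ x∙yz≈y∙xz _ _ _ ⟩
      pow (- 1#) b * (Wp p (suc b) 1 * (x * (c b * pow x b)))
        ≈⟨ *-congˡ (*-congˡ (x∙yz≈y∙xz _ _ _)) ⟩
      pow (- 1#) b * (Wp p (suc b) 1 * (c b * (x * pow x b)))
        ≈⟨ *-congˡ (trans (sym (*-assoc _ _ _)) (*-congʳ (Wp1*c≈c p b))) ⟩
      Y ∎

  module _ (f : ℕ → Carrier) (f-mult : Multiplicative f) where

    binomialWeight : ℕ → ℕ → Carrier
    binomialWeight n d = fromℕ (binomCoeff n d)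

    binomialLocalWeight : ℕ → ℕ → ℕ → Carrier
    binomialLocalWeight _ a i = fromℕ (a C i)

    binomialCandidate : ℕ → Carrier
    binomialCandidate n = pow (- 1#) (Ω n) * (fromℕ (ξ n) * primePowProd f n)

    dirichletCandidate : ℕ → Carrier
    dirichletCandidate n = pow (- 1#) (Ω n) * primePowProd f n

    mutual
      binomial≈convolution : ∀ g n → binomial f g n ≈ convolution binomialWeight f g n
      binomial≈convolution g n =
        trans (foldr-map-cong (binomial-summand g n) (upTo n)) (reflexive (foldr-map-upTo _ n))

      -- The `_` is the summand of `binomial` in Defs, which is local to a `where` block and cannot be named.
      binomial-summand : ∀ g n k → _ ≈ divisorTerm n (convolutionTerm binomialWeight f g n) k
      binomial-summand g n k with suc k ∣? n
      ... | yes _ = refl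
      ... | no  _ = refl

    mutual
      dirichlet≈convolution : ∀ g n → dirichlet f g n ≈ convolution (λ _ _ → 1#) f g n
      dirichlet≈convolution g n =
        trans (foldr-map-cong (dirichlet-summand g n) (upTo n)) (reflexive (foldr-map-upTo _ n))

      dirichlet-summand : ∀ g n k → _ ≈ divisorTerm n (convolutionTerm (λ _ _ → 1#) f g n) k
      dirichlet-summand g n k with suc k ∣? n
      ... | yes _ = sym (*-identityˡ _)
      ... | no  _ = refl

    binomialWeight-splits : SplitsOffPrimePowers₂ binomialWeight binomialLocalWeight
    binomialWeight-splits {m = m} {e} {a} {i} p-prime 1≤m p∤m e∣m i≤a =
      trans (reflexive (cong fromℕ (binomCoeff-split p-prime 1≤m p∤m e∣m i≤a)))
            (fromℕ-* (a C i) (binomCoeff m e))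

    binomialCandidate-splits : SplitsOffPrimePowers binomialCandidate (alternating (λ j → fromℕ (j !)) f)
    binomialCandidate-splits {k = k} j p-prime 1≤k p∤k = trans
      (*-cong (trans (reflexive (cong (pow (- 1#)) (Ω-split p-prime 1≤k p∤k j))) (pow-+ _ j (Ω k)))
              (*-cong (trans (reflexive (cong fromℕ (ξ-split p-prime 1≤k p∤k j))) (fromℕ-* (j !) (ξ k)))
                      (primePowProd-split f p-prime 1≤k p∤k j)))
      (trans (*-congˡ (interchange _ _ _ _)) (interchange _ _ _ _))

    dirichletCandidate-splits : SplitsOffPrimePowers dirichletCandidate (alternating (λ _ → 1#) f)
    dirichletCandidate-splits {k = k} j p-prime 1≤k p∤k = trans
      (*-cong (trans (reflexive (cong (pow (- 1#)) (Ω-split p-prime 1≤k p∤k j))) (pow-+ _ j (Ω k)))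
              (primePowProd-split f p-prime 1≤k p∤k j))
      (trans (interchange _ _ _ _) (*-congʳ (*-congˡ (sym (*-identityˡ _)))))

    module _ (f-vanishes : ∀ p a → Prime p → 2 ≤ a → f (p ^ a) ≈ 0#) where

      binomialCandidate-isInverse : IsInverse binomialWeight f binomialCandidate
      binomialCandidate-isInverse =
        inverse-exists {Wp = binomialLocalWeight} f-mult binomialWeight-splits binomialCandidate-splits
          fromℕ-1 (trans (*-identityˡ _) (trans (*-identityʳ _) fromℕ-1))
          (localFactor-vanishes (proj₁ f-mult) f-vanishes {binomialLocalWeight} (λ _ _ → fromℕ-1) a*[a-1]!≈a!)
        where
        a*[a-1]!≈a! : ∀ p b → binomialLocalWeight p (suc b) 1 * fromℕ (b !) ≈ fromℕ (suc b !)
        a*[a-1]!≈a! _ b = trans (*-congʳ (reflexive (cong fromℕ (nC1≡n (suc b))))) (sym (fromℕ-* (suc b) (b !)))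

      dirichletCandidate-isInverse : IsInverse (λ _ _ → 1#) f dirichletCandidate
      dirichletCandidate-isInverse =
        inverse-exists {Wp = λ _ _ _ → 1#} f-mult (λ _ _ _ _ _ → sym (*-identityˡ 1#)) dirichletCandidate-splits
          refl (*-identityˡ _)
          (localFactor-vanishes (proj₁ f-mult) f-vanishes {λ _ _ _ → 1#} (λ _ _ → refl) (λ _ _ → *-identityˡ 1#))

      binomial-inverse : ∀ g → IsBinomialInverse f g → ∀ n → 1 ≤ n → g n ≈ binomialCandidate n
      binomial-inverse g g-inverse =
        inverse-unique binomialWeight (proj₁ f-mult) binomialWeight[n,1]≈1
          (λ n 1≤n → trans (sym (binomial≈convolution g n)) (g-inverse n 1≤n)) binomialCandidate-isInverse
        where
        binomialWeight[n,1]≈1 : ∀ n → binomialWeight n 1 ≈ 1#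
        binomialWeight[n,1]≈1 n = trans (reflexive (cong fromℕ (binomCoeff[n,1] n))) fromℕ-1

      dirichlet-inverse : ∀ h → IsDirichletInverse f h → ∀ n → 1 ≤ n → h n ≈ dirichletCandidate n
      dirichlet-inverse h h-inverse =
        inverse-unique (λ _ _ → 1#) (proj₁ f-mult) (λ _ → refl)
          (λ n 1≤n → trans (sym (dirichlet≈convolution h n)) (h-inverse n 1≤n)) dirichletCandidate-isInverse

theorem2p3 : ∀ {c ℓ : Level} (R : CommutativeRing c ℓ) →
    let open CommutativeRing R
        open Arith R
    in
    (f : ℕ → Carrier) → Multiplicative f →
    (∀ p a → Prime p → 2 ≤ a → f (p ^ a) ≈ 0#) →
    (∀ g → IsBinomialInverse f g → ∀ n → 1 ≤ n →
       (g n ≈ pow (- 1#) (Ω n) * (fromℕ (ξ n) * primePowProd f n))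
       × (g n ≈ liouville n * (fromℕ (ξ n) * primePowProd f n)))
    × (∀ h → IsDirichletInverse f h → ∀ n → 1 ≤ n →
       (h n ≈ pow (- 1#) (Ω n) * primePowProd f n)
       × (h n ≈ liouville n * primePowProd f n))
theorem2p3 R f f-mult f-vanishes =
  (λ g g-inverse n 1≤n → let g≈ = binomial-inverse f f-mult f-vanishes g g-inverse n 1≤n in g≈ , g≈) ,
  (λ h h-inverse n 1≤n → let h≈ = dirichlet-inverse f f-mult f-vanishes h h-inverse n 1≤n in h≈ , h≈)
  where open Inverses R
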